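{- Let $n\geq 2$ and $i\in\mathbb{Z}_{2n+1}$. In $\vec{C}_{2n+1}\langle n\rangle$, the set $\{i,i+n,i+n+1\}$ induces an acyclic subdigraph which is maximal: for every $j\in\mathbb{Z}_{2n+1}\setminus\{i,i+n,i+n+1\}$, the set $\{j,i,i+n,i+n+1\}$ induces a subdigraph containing a directed cycle.
   Context: For $n\ge2$, $\vec{C}_{2n+1}\langle n\rangle$ is the tournament with vertex set $\mathbb{Z}_{2n+1}$ and arcs $(a,a+j)$ for all $a\in\mathbb{Z}_{2n+1}$, $j\in\{1,\dots,n-1\}$, together with arcs $(a,a-n)$ for all $a\in\mathbb{Z}_{2n+1}$. -}

module Defs where

open import Data.Nat using (ℕ; zero; suc; _+_; _∸_; _≤_; _<_)
open import Data.Nat.DivMod using (_%_)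
open import Data.Fin using (Fin; toℕ; fromℕ<)
open import Data.Nat.DivMod using (m%n<n)
open import Data.List using (List; []; _∷_; length)
open import Data.List.Membership.Propositional using (_∈_)
open import Data.List.Relation.Unary.All using (All)
open import Data.List.Relation.Unary.Unique.Propositional using (Unique)
open import Data.Product using (Σ; _×_; ∃)
open import Data.Sum using (_⊎_)
open import Relation.Binary.PropositionalEquality using (_≡_)
open import Relation.Nullary using (¬_)

ℤ[_] : ℕ → Set
ℤ[ n ] = Fin (suc (n + n))

addℕ : (n : ℕ) → ℤ[ n ] → ℕ → ℤ[ n ]
addℕ n a k = fromℕ< (m%n<n (toℕ a + k) (suc (n + n)))

diff : (n : ℕ) → ℤ[ n ] → ℤ[ n ] → ℕ
diff n a b = (toℕ b + (suc (n + n) ∸ toℕ a)) % suc (n + n)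

-- The tournament C_{2n+1}<n>: arc (a, a+j) for j ∈ {1,…,n-1}, and arc (a, a-n).
-- Note a - n ≡ a + (n+1) (mod 2n+1).
Arc : (n : ℕ) → ℤ[ n ] → ℤ[ n ] → Set
Arc n a b = (1 ≤ diff n a b × diff n a b ≤ n ∸ 1) ⊎ diff n a b ≡ suc n

data IsPath (n : ℕ) : List ℤ[ n ] → Set where
  single : ∀ v → IsPath n (v ∷ [])
  step   : ∀ u v vs → Arc n u v → IsPath n (v ∷ vs) → IsPath n (u ∷ v ∷ vs)

last : {A : Set} → A → List A → A
last a [] = a
last a (b ∷ bs) = last b bs

DirectedCycleIn : (n : ℕ) → List ℤ[ n ] → Set
DirectedCycleIn n S =
  Σ ℤ[ n ] λ v → Σ (List ℤ[ n ]) λ vs →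
    (1 ≤ length vs) × IsPath n (v ∷ vs) × Arc n (last v vs) v
    × Unique (v ∷ vs) × All (_∈ S) (v ∷ vs)

Acyclic : (n : ℕ) → List ℤ[ n ] → Set
Acyclic n S = ¬ DirectedCycleIn n S

{-# OPTIONS --safe #-}
module Submission where

-- Whether a → b is an arc depends only on d = b − a (mod 2n+1): it is one iff 1 ≤ d ≤ n−1 or
-- d = n+1.  On {i, a = i+n, b = i+n+1} the arcs are a → i, a → b and i → b, so the order
-- a < i < b increases along every arc.  Any other vertex j = i+d closes a directed triangle:
-- i → j → a → i when 1 ≤ d ≤ n−1, and i → b → j → i when d = n+1+e with 1 ≤ e ≤ n−1.

open import Defs
open import Data.Nat using (ℕ; zero; suc; _+_; _∸_; _≤_; _<_; z≤n; s≤s; NonZero)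
open import Data.Nat.Properties
open import Data.Nat.DivMod using (_%_; m%n<n; m%n%n≡m%n; %-distribˡ-+; [m+n]%n≡m%n; m<n⇒m%n≡m)
open import Data.Fin using (toℕ)
open import Data.Fin.Properties using (toℕ-fromℕ<; toℕ-injective; toℕ<n)
open import Data.List using (List; []; _∷_)
open import Data.List.Membership.Propositional using (_∈_; _∉_)
open import Data.List.Relation.Unary.Any using (here; there)
open import Data.List.Relation.Unary.All as All using (All; []; _∷_)
open import Data.List.Relation.Unary.AllPairs using ([]; _∷_)
open import Data.Product using (_×_; _,_)
open import Data.Sum using (_⊎_; inj₁; inj₂)
open import Data.Empty using (⊥-elim)
open import Function using (_∘_)
open import Relation.Binary using (tri<; tri≈; tri>)
open import Relation.Binary.PropositionalEquality
open import Relation.Nullary using (¬_)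

[m%d+n]%d≡[m+n]%d : ∀ m n d .{{_ : NonZero d}} → (m % d + n) % d ≡ (m + n) % d
[m%d+n]%d≡[m+n]%d m n d = begin
  (m % d + n) % d           ≡⟨ %-distribˡ-+ (m % d) n d ⟩
  (m % d % d + n % d) % d   ≡⟨ cong (λ t → (t + n % d) % d) (m%n%n≡m%n m d) ⟩
  (m % d + n % d) % d       ≡⟨ %-distribˡ-+ m n d ⟨
  (m + n) % d               ∎
  where open ≡-Reasoning

<⇒≤∸1 : ∀ {m n} → m < n → m ≤ n ∸ 1
<⇒≤∸1 (s≤s m≤n) = m≤n

≤∸1⇒< : ∀ {m n} → 1 ≤ m → m ≤ n ∸ 1 → m < n
≤∸1⇒< {n = zero}  (s≤s z≤n) ()
≤∸1⇒< {n = suc n} _         m≤n = s≤s m≤n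

All-last : ∀ {A : Set} {P : A → Set} {v vs} → All P (v ∷ vs) → P (last v vs)
All-last {vs = []}    (p ∷ []) = p
All-last {vs = _ ∷ _} (_ ∷ ps) = All-last ps

module _ (n : ℕ) where

  private
    M : ℕ
    M = suc (n + n)

  toℕ-addℕ : ∀ a c → toℕ (addℕ n a c) ≡ (toℕ a + c) % M
  toℕ-addℕ a c = toℕ-fromℕ< _

  addℕ-zero : ∀ a → addℕ n a 0 ≡ a
  addℕ-zero a = toℕ-injective (begin
    toℕ (addℕ n a 0)  ≡⟨ toℕ-addℕ a 0 ⟩
    (toℕ a + 0) % M   ≡⟨ cong (_% M) (+-identityʳ (toℕ a)) ⟩
    toℕ a % M         ≡⟨ m<n⇒m%n≡m (toℕ<n a) ⟩
    toℕ a             ∎)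
    where open ≡-Reasoning

  addℕ-addℕ : ∀ a c d → addℕ n (addℕ n a c) d ≡ addℕ n a (c + d)
  addℕ-addℕ a c d = toℕ-injective (begin
    toℕ (addℕ n (addℕ n a c) d)  ≡⟨ toℕ-addℕ (addℕ n a c) d ⟩
    (toℕ (addℕ n a c) + d) % M   ≡⟨ cong (λ t → (t + d) % M) (toℕ-addℕ a c) ⟩
    ((toℕ a + c) % M + d) % M    ≡⟨ [m%d+n]%d≡[m+n]%d (toℕ a + c) d M ⟩
    (toℕ a + c + d) % M          ≡⟨ cong (_% M) (+-assoc (toℕ a) c d) ⟩
    (toℕ a + (c + d)) % M        ≡⟨ toℕ-addℕ a (c + d) ⟨
    toℕ (addℕ n a (c + d))       ∎)
    where open ≡-Reasoning

  addℕ-period : ∀ a c → addℕ n a (c + M) ≡ addℕ n a c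
  addℕ-period a c = toℕ-injective (begin
    toℕ (addℕ n a (c + M))  ≡⟨ toℕ-addℕ a (c + M) ⟩
    (toℕ a + (c + M)) % M   ≡⟨ cong (_% M) (+-assoc (toℕ a) c M) ⟨
    (toℕ a + c + M) % M     ≡⟨ [m+n]%n≡m%n (toℕ a + c) M ⟩
    (toℕ a + c) % M         ≡⟨ toℕ-addℕ a c ⟨
    toℕ (addℕ n a c)        ∎)
    where open ≡-Reasoning

  addℕ-full-turn : ∀ a → addℕ n a M ≡ a
  addℕ-full-turn a = trans (addℕ-period a 0) (addℕ-zero a)

  diff-addℕ : ∀ a c → c < M → diff n a (addℕ n a c) ≡ c
  diff-addℕ a c c<M = begin
    (toℕ (addℕ n a c) + (M ∸ toℕ a)) % M   ≡⟨ cong (λ t → (t + (M ∸ toℕ a)) % M) (toℕ-addℕ a c) ⟩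
    ((toℕ a + c) % M + (M ∸ toℕ a)) % M    ≡⟨ [m%d+n]%d≡[m+n]%d (toℕ a + c) (M ∸ toℕ a) M ⟩
    (toℕ a + c + (M ∸ toℕ a)) % M          ≡⟨ cong (λ t → (t + (M ∸ toℕ a)) % M) (+-comm (toℕ a) c) ⟩
    (c + toℕ a + (M ∸ toℕ a)) % M          ≡⟨ cong (_% M) (+-assoc c (toℕ a) (M ∸ toℕ a)) ⟩
    (c + (toℕ a + (M ∸ toℕ a))) % M        ≡⟨ cong (λ t → (c + t) % M) (m+[n∸m]≡n (<⇒≤ (toℕ<n a))) ⟩
    (c + M) % M                            ≡⟨ [m+n]%n≡m%n c M ⟩
    c % M                                  ≡⟨ m<n⇒m%n≡m c<M ⟩
    c                                      ∎
    where open ≡-Reasoning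

  addℕ-diff : ∀ a b → addℕ n a (diff n a b) ≡ b
  addℕ-diff a b = toℕ-injective (begin
    toℕ (addℕ n a (diff n a b))                  ≡⟨ toℕ-addℕ a (diff n a b) ⟩
    (toℕ a + (toℕ b + (M ∸ toℕ a)) % M) % M      ≡⟨ cong (_% M) (+-comm (toℕ a) _) ⟩
    ((toℕ b + (M ∸ toℕ a)) % M + toℕ a) % M      ≡⟨ [m%d+n]%d≡[m+n]%d (toℕ b + (M ∸ toℕ a)) (toℕ a) M ⟩
    (toℕ b + (M ∸ toℕ a) + toℕ a) % M            ≡⟨ cong (_% M) (+-assoc (toℕ b) (M ∸ toℕ a) (toℕ a)) ⟩
    (toℕ b + ((M ∸ toℕ a) + toℕ a)) % M          ≡⟨ cong (λ t → (toℕ b + t) % M) (m∸n+n≡m (<⇒≤ (toℕ<n a))) ⟩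
    (toℕ b + M) % M                              ≡⟨ [m+n]%n≡m%n (toℕ b) M ⟩
    toℕ b % M                                    ≡⟨ m<n⇒m%n≡m (toℕ<n b) ⟩
    toℕ b                                        ∎)
    where open ≡-Reasoning

  diff<order : ∀ a b → diff n a b < M
  diff<order a b = m%n<n (toℕ b + (M ∸ toℕ a)) M

  diff-≡ : ∀ {a b c} → addℕ n a c ≡ b → c < M → diff n a b ≡ c
  diff-≡ {a} {c = c} refl = diff-addℕ a c

  Short : ℕ → Set
  Short d = 1 ≤ d × d ≤ n ∸ 1

  ArcLength : ℕ → Set
  ArcLength d = Short d ⊎ d ≡ suc n

  ¬ArcLength-0 : ¬ ArcLength 0
  ¬ArcLength-0 (inj₁ (() , _))
  ¬ArcLength-0 (inj₂ ())

  ¬ArcLength-n : ¬ ArcLength n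
  ¬ArcLength-n (inj₁ (1≤n , n≤n∸1)) = <-irrefl refl (≤∸1⇒< 1≤n n≤n∸1)
  ¬ArcLength-n (inj₂ n≡1+n)         = <-irrefl n≡1+n (n<1+n n)

  Short-complement : ∀ {d} → Short d → Short (n ∸ d)
  Short-complement (1≤d , d≤n∸1) = m<n⇒0<n∸m (≤∸1⇒< 1≤d d≤n∸1) , ∸-monoʳ-≤ n 1≤d

  Short⇒≤ : ∀ {d} → Short d → d ≤ n
  Short⇒≤ (1≤d , d≤n∸1) = <⇒≤ (≤∸1⇒< 1≤d d≤n∸1)

  no-arc-of-length : ∀ {a b c} → addℕ n a c ≡ b → c < M → ¬ ArcLength c → ¬ Arc n a b
  no-arc-of-length {a} {b} {c} a+c≡b c<M ¬c = ¬c ∘ subst ArcLength (diff-≡ {a} {b} {c} a+c≡b c<M)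

  no-loop : ∀ {v} → ¬ Arc n v v
  no-loop {v} = no-arc-of-length {v} {v} {0} (addℕ-zero v) (s≤s z≤n) ¬ArcLength-0

  arc⇒≢ : ∀ {u v} → Arc n u v → u ≢ v
  arc⇒≢ {u} uv refl = no-loop {u} uv

  module _ {S : List ℤ[ n ]} (rank : ∀ {u} → u ∈ S → ℕ)
           (rank-increasing : ∀ {u w} (p : u ∈ S) (q : w ∈ S) → Arc n u w → rank p < rank q) where

    rank-monotone-along-path : ∀ {v vs} → IsPath n (v ∷ vs) → (ps : All (_∈ S) (v ∷ vs)) →
                               rank (All.head ps) ≤ rank (All-last ps)
    rank-monotone-along-path (single _)           (_ ∷ [])     = ≤-refl
    rank-monotone-along-path (step _ _ _ uv path) (p ∷ q ∷ ps) =
      ≤-trans (<⇒≤ (rank-increasing p q uv)) (rank-monotone-along-path path (q ∷ ps))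

    acyclic-by-rank : Acyclic n S
    acyclic-by-rank (_ , [] , () , _)
    acyclic-by-rank (_ , _ ∷ _ , _ , step _ _ _ vw path , closing , _ , p ∷ ps) =
      <-asym (<-≤-trans (rank-increasing p (All.head ps) vw) (rank-monotone-along-path path ps))
             (rank-increasing (All-last ps) p closing)

  triangle-cycle : ∀ {S u v w} → u ∈ S → v ∈ S → w ∈ S →
                   Arc n u v → Arc n v w → Arc n w u → DirectedCycleIn n S
  triangle-cycle u∈S v∈S w∈S uv vw wu =
    _ , _ ∷ _ ∷ [] , s≤s z≤n , step _ _ _ uv (step _ _ _ vw (single _)) , wu ,
    (arc⇒≢ uv ∷ ≢-sym (arc⇒≢ wu) ∷ []) ∷ (arc⇒≢ vw ∷ []) ∷ [] ∷ [] ,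
    u∈S ∷ v∈S ∷ w∈S ∷ []

  data OffsetView : ℕ → Set where
    offset-0     : OffsetView 0
    short        : ∀ {d} → Short d → OffsetView d
    offset-n     : OffsetView n
    offset-suc-n : OffsetView (suc n)
    long         : ∀ {e} → Short e → OffsetView (suc n + e)

  offsetView : ∀ d → d < M → OffsetView d
  offsetView d d<M with <-cmp d n
  ... | tri< d<n _ _ = below d d<n
    where
    below : ∀ d → d < n → OffsetView d
    below zero    _   = offset-0
    below (suc d) d<n = short (s≤s z≤n , <⇒≤∸1 d<n)
  ... | tri≈ _ refl _ = offset-n
  ... | tri> _ _ n<d with m≤n⇒∃[o]m+o≡n n<d
  ... | e , refl = above e (+-cancelˡ-< (suc n) e n d<M)
    where
    above : ∀ e → e < n → OffsetView (suc n + e)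
    above zero    _   = subst OffsetView (sym (+-identityʳ (suc n))) offset-suc-n
    above (suc e) e<n = long (s≤s z≤n , <⇒≤∸1 e<n)

  module _ (2≤n : 2 ≤ n) where

    ¬ArcLength-n+n : ¬ ArcLength (n + n)
    ¬ArcLength-n+n (inj₁ (_ , n+n≤n∸1)) =
      ≤⇒≯ (m≤m+n n n) (≤-<-trans n+n≤n∸1 (∸-monoʳ-< (s≤s z≤n) (<⇒≤ 2≤n)))
    ¬ArcLength-n+n (inj₂ n+n≡1+n) =
      <-irrefl refl (subst (2 ≤_) (+-cancelˡ-≡ n n 1 (trans n+n≡1+n (+-comm 1 n))) 2≤n)

    ArcLength⇒<order : ∀ {d} → ArcLength d → d < M
    ArcLength⇒<order (inj₁ (_ , d≤n∸1)) = s≤s (≤-trans d≤n∸1 (≤-trans (m∸n≤m n 1) (m≤m+n n n)))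
    ArcLength⇒<order (inj₂ refl)        = s≤s (+-monoˡ-≤ n (<⇒≤ 2≤n))

    arc-of-length : ∀ {a b c} → addℕ n a c ≡ b → ArcLength c → Arc n a b
    arc-of-length {a} {b} {c} a+c≡b ℓ = subst ArcLength (sym (diff-≡ {a} {b} {c} a+c≡b (ArcLength⇒<order ℓ))) ℓ

    module AntipodalTriple (i : ℤ[ n ]) where

      a b : ℤ[ n ]
      a = addℕ n i n
      b = addℕ n i (n + 1)

      triple : List ℤ[ n ]
      triple = i ∷ a ∷ b ∷ []

      open ≡-Reasoning

      i+[1+n]≡b : addℕ n i (suc n) ≡ b
      i+[1+n]≡b = cong (addℕ n i) (+-comm 1 n)

      a+[1+n]≡i : addℕ n a (suc n) ≡ i
      a+[1+n]≡i = begin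
        addℕ n a (suc n)      ≡⟨ addℕ-addℕ i n (suc n) ⟩
        addℕ n i (n + suc n)  ≡⟨ cong (addℕ n i) (+-suc n n) ⟩
        addℕ n i M            ≡⟨ addℕ-full-turn i ⟩
        i                     ∎

      b+n≡i : addℕ n b n ≡ i
      b+n≡i = begin
        addℕ n b n             ≡⟨ addℕ-addℕ i (n + 1) n ⟩
        addℕ n i (n + 1 + n)   ≡⟨ cong (λ t → addℕ n i (t + n)) (+-comm n 1) ⟩
        addℕ n i M             ≡⟨ addℕ-full-turn i ⟩
        i                      ∎

      b+[n+n]≡a : addℕ n b (n + n) ≡ a
      b+[n+n]≡a = begin
        addℕ n b (n + n)           ≡⟨ addℕ-addℕ i (n + 1) (n + n) ⟩
        addℕ n i (n + 1 + (n + n)) ≡⟨ cong (addℕ n i) (+-assoc n 1 (n + n)) ⟩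
        addℕ n i (n + M)           ≡⟨ addℕ-period i n ⟩
        a                          ∎

      rank : ∀ {u} → u ∈ triple → ℕ
      rank (here _)                 = 1
      rank (there (here _))         = 0
      rank (there (there (here _))) = 2

      rank-increasing : ∀ {u w} (p : u ∈ triple) (q : w ∈ triple) → Arc n u w → rank p < rank q
      rank-increasing (here refl)                 (here refl)                 = ⊥-elim ∘ no-loop {i}
      rank-increasing (here refl)                 (there (here refl))         =
        ⊥-elim ∘ no-arc-of-length {i} {a} {n} refl (s≤s (m≤m+n n n)) ¬ArcLength-n
      rank-increasing (here refl)                 (there (there (here refl))) = λ _ → s≤s (s≤s z≤n)
      rank-increasing (there (here refl))         (here refl)                 = λ _ → s≤s z≤n
      rank-increasing (there (here refl))         (there (here refl))         = ⊥-elim ∘ no-loop {a}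
      rank-increasing (there (here refl))         (there (there (here refl))) = λ _ → s≤s z≤n
      rank-increasing (there (there (here refl))) (here refl)                 =
        ⊥-elim ∘ no-arc-of-length {b} {i} {n} b+n≡i (s≤s (m≤m+n n n)) ¬ArcLength-n
      rank-increasing (there (there (here refl))) (there (here refl))         =
        ⊥-elim ∘ no-arc-of-length {b} {a} {n + n} b+[n+n]≡a (n<1+n (n + n)) ¬ArcLength-n+n
      rank-increasing (there (there (here refl))) (there (there (here refl))) = ⊥-elim ∘ no-loop {b}

      acyclic : Acyclic n triple
      acyclic = acyclic-by-rank rank rank-increasing

      cycle-at-offset : ∀ {d} → OffsetView d → addℕ n i d ∉ triple → DirectedCycleIn n (addℕ n i d ∷ triple)
      cycle-at-offset offset-0     ∉triple = ⊥-elim (∉triple (here (addℕ-zero i)))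
      cycle-at-offset offset-n     ∉triple = ⊥-elim (∉triple (there (here refl)))
      cycle-at-offset offset-suc-n ∉triple = ⊥-elim (∉triple (there (there (here i+[1+n]≡b))))
      cycle-at-offset (short {d} s) _ =
        triangle-cycle (there (here refl)) (here refl) (there (there (here refl)))
          (arc-of-length {i} {j} {d} refl (inj₁ s))
          (arc-of-length {j} {a} {n ∸ d} j+[n∸d]≡a (inj₁ (Short-complement s)))
          (arc-of-length {a} {i} {suc n} a+[1+n]≡i (inj₂ refl))
        where
        j : ℤ[ n ]
        j = addℕ n i d
        j+[n∸d]≡a : addℕ n j (n ∸ d) ≡ a
        j+[n∸d]≡a = trans (addℕ-addℕ i d (n ∸ d)) (cong (addℕ n i) (m+[n∸m]≡n (Short⇒≤ s)))
      cycle-at-offset (long {e} s) _ =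
        triangle-cycle (there (here refl)) (there (there (there (here refl)))) (here refl)
          (arc-of-length {i} {b} {suc n} i+[1+n]≡b (inj₂ refl))
          (arc-of-length {b} {j} {e} b+e≡j (inj₁ s))
          (arc-of-length {j} {i} {n ∸ e} j+[n∸e]≡i (inj₁ (Short-complement s)))
        where
        j : ℤ[ n ]
        j = addℕ n i (suc n + e)
        b+e≡j : addℕ n b e ≡ j
        b+e≡j = trans (addℕ-addℕ i (n + 1) e) (cong (λ t → addℕ n i (t + e)) (+-comm n 1))
        j+[n∸e]≡i : addℕ n j (n ∸ e) ≡ i
        j+[n∸e]≡i = begin
          addℕ n j (n ∸ e)                   ≡⟨ addℕ-addℕ i (suc n + e) (n ∸ e) ⟩
          addℕ n i (suc n + e + (n ∸ e))     ≡⟨ cong (addℕ n i) (+-assoc (suc n) e (n ∸ e)) ⟩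
          addℕ n i (suc n + (e + (n ∸ e)))   ≡⟨ cong (λ t → addℕ n i (suc n + t)) (m+[n∸m]≡n (Short⇒≤ s)) ⟩
          addℕ n i M                         ≡⟨ addℕ-full-turn i ⟩
          i                                  ∎

      maximal : (j : ℤ[ n ]) → j ∉ triple → DirectedCycleIn n (j ∷ triple)
      maximal j = subst (λ v → v ∉ triple → DirectedCycleIn n (v ∷ triple)) (addℕ-diff i j)
                        (cycle-at-offset (offsetView (diff n i j) (diff<order i j)))

lemma3 : (n : ℕ) → 2 ≤ n → (i : ℤ[ n ]) →
    Acyclic n (i ∷ addℕ n i n ∷ addℕ n i (n + 1) ∷ [])
    × ((j : ℤ[ n ]) → j ∉ (i ∷ addℕ n i n ∷ addℕ n i (n + 1) ∷ []) →
       DirectedCycleIn n (j ∷ i ∷ addℕ n i n ∷ addℕ n i (n + 1) ∷ []))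
lemma3 n 2≤n i = acyclic , maximal
  where open AntipodalTriple n 2≤n i
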